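{- Let $Q\ge3$. Let $\mathscr D_Q^{(1)}$ be the set of pairs $(q_1,q_2)$ such that $a_1/q_1<a_2/q_2$ are consecutive elements of $\mathfrak{SF}_Q$ and are also consecutive elements of the Farey set $\mathcal F_Q$. Then $\mathscr D_Q^{(1)}\subseteq Q\mathcal V_1$, where $\mathcal V_1:=\{(x,y)\in[1/2,1]\times[1/3,1]:\max\{1-x,2x-1\}\le y\le x\}$.
   Context: $\mathcal F_Q:=\{d/b: d,b\in\mathbb N,\ 1\le d\le b\le Q,\ \gcd(d,b)=1\}$. For a reduced fraction $a/q\in\mathbb Q\cap(0,1]$ with $q\ge 2$, let $\bar a$ denote the multiplicative inverse of $a$ modulo $q$ in $[1,q)$, and set $h(a/q):=q+a+\bar a$; set $h(1/1):=3$. $\mathfrak{SF}_Q:=\{a/q\in\mathbb Q\cap(0,1]: h(a/q)\le Q\}\subseteq\mathcal F_Q$. Consecutive means adjacent in the increasing ordering of the respective set. $Q\mathcal V_1=\{(Qx,Qy):(x,y)\in\mathcal V_1\}$. -}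

module Defs where

open import Data.Nat using (ℕ; suc; _+_; _*_; _≤_; _<_; _∸_)
open import Data.Nat.Coprimality using (Coprime)
open import Data.Product using (_×_; ∃)
open import Data.Sum using (_⊎_)
open import Relation.Binary.PropositionalEquality using (_≡_)
open import Relation.Nullary using (¬_)

-- A fraction a/q is represented by the pair (a , q) of naturals.
-- Value order for positive denominators: a/q < c/r  iff  a * r < c * q.
_⟨_⟩<⟨_⟩_ : ℕ → ℕ → ℕ → ℕ → Set
a ⟨ q ⟩<⟨ c ⟩ r = a * r < c * q

InFarey : ℕ → ℕ → ℕ → Set
InFarey Q d b = 1 ≤ d × d ≤ b × b ≤ Q × Coprime d b

IsInvMod : ℕ → ℕ → ℕ → Set
IsInvMod q a abar = 1 ≤ abar × abar < q × ∃ λ k → a * abar ≡ 1 + k * q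

HLe : ℕ → ℕ → ℕ → Set
HLe Q a q = (a ≡ 1 × q ≡ 1 × 3 ≤ Q)
          ⊎ (2 ≤ q × ∃ λ abar → IsInvMod q a abar × q + a + abar ≤ Q)

InSF : ℕ → ℕ → ℕ → Set
InSF Q a q = 1 ≤ a × a ≤ q × Coprime a q × HLe Q a q

-- a1/q1 < a2/q2 are consecutive elements of the set given by predicate S
-- (elements represented by reduced pairs, so the representation is unique).
Consecutive : (ℕ → ℕ → Set) → ℕ → ℕ → ℕ → ℕ → Set
Consecutive S a₁ q₁ a₂ q₂ =
  S a₁ q₁ × S a₂ q₂ × a₁ ⟨ q₁ ⟩<⟨ a₂ ⟩ q₂ ×
  (∀ c r → S c r → ¬ (a₁ ⟨ q₁ ⟩<⟨ c ⟩ r × c ⟨ r ⟩<⟨ a₂ ⟩ q₂))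

-- (x , y) ∈ Q·V₁ where V₁ = {(x,y) ∈ [1/2,1]×[1/3,1] : max{1-x, 2x-1} ≤ y ≤ x},
-- cleared of denominators: x/Q ∈ [1/2,1], y/Q ∈ [1/3,1],
-- Q - x ≤ y, 2x - Q ≤ y, y ≤ x.
InQV₁ : ℕ → ℕ → ℕ → Set
InQV₁ Q x y =
  Q ≤ 2 * x × x ≤ Q × Q ≤ 3 * y × y ≤ Q ×
  Q ≤ x + y × 2 * x ≤ Q + y × y ≤ x

-- Farey neighbours a₁/q₁ < a₂/q₂ in F_Q satisfy a₂q₁ − a₁q₂ = 1 and q₁ + q₂ > Q: the fraction a/q with
-- aq₁ − a₁q = 1 and Q − q₁ < q ≤ Q lies in F_Q, cannot lie strictly between them, and cannot lie beyond
-- a₂/q₂, since then q₂ ≥ q₁ + q > Q. Hence q₁ is an inverse of a₂ modulo q₂ and −q₂ one of a₁ modulo q₁.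
-- If q₁ < q₂, then ā₂ = q₁ and h(a₂/q₂) ≥ q₂ + q₁ > Q; as gcd(q₁, q₂) = 1 this forces q₂ < q₁, and then
-- ā₁ = q₁ − q₂. All inequalities defining Q·V₁ now follow linearly from h(a₁/q₁) = 2q₁ + a₁ − q₂ ≤ Q < q₁ + q₂.
module Submission where

open import Defs
open import Data.Nat using (ℕ; _≤_; _+_; _*_; _∸_; _<_; NonZero; >-nonZero; _/_; _%_)
open import Data.Nat.Properties
open import Data.Nat.DivMod using (m≡m%n+[m/n]*n; m%n<n)
open import Data.Nat.Divisibility
  using (_∣_; divides; ∣⇒≤; ∣-refl; ∣-reflexive; ∣-antisym; ∣1⇒≡1; ∣m+n∣m⇒∣n; ∣m⇒∣m*n; ∣n⇒∣m*n; m∣m*n; n∣m*n)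
open import Data.Nat.Coprimality using (Coprime; coprime-divisor)
import Data.Nat.Coprimality as Coprime
open import Data.Nat.Tactic.RingSolver using (solve)
open import Data.List using (_∷_; [])
open import Data.Product using (_×_; _,_; ∃; ∃₂)
open import Data.Sum using (inj₁; inj₂)
open import Data.Empty using (⊥-elim)
open import Relation.Binary using (tri<; tri≈; tri>)
open import Relation.Binary.PropositionalEquality
  using (_≡_; _≢_; refl; sym; trans; cong; subst; module ≡-Reasoning)
open import Relation.Nullary using (¬_)

infix 4 _≡_mod_

_≡_mod_ : ℕ → ℕ → ℕ → Set
x ≡ y mod q = ∃₂ λ m n → x + m * q ≡ y + n * q

≡-mod-sym : ∀ {x y q} → x ≡ y mod q → y ≡ x mod q
≡-mod-sym (m , n , eq) = n , m , sym eq

≡-mod-trans : ∀ {x y z q} → x ≡ y mod q → y ≡ z mod q → x ≡ z mod q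
≡-mod-trans {x} {y} {z} {q} (m , n , x≡y) (m′ , n′ , y≡z) = m + m′ , n′ + n , (begin
  x + (m + m′) * q      ≡⟨ solve (x ∷ m ∷ m′ ∷ q ∷ []) ⟩
  (x + m * q) + m′ * q  ≡⟨ cong (_+ m′ * q) x≡y ⟩
  (y + n * q) + m′ * q  ≡⟨ solve (y ∷ n ∷ m′ ∷ q ∷ []) ⟩
  (y + m′ * q) + n * q  ≡⟨ cong (_+ n * q) y≡z ⟩
  (z + n′ * q) + n * q  ≡⟨ solve (z ∷ n′ ∷ n ∷ q ∷ []) ⟩
  z + (n′ + n) * q      ∎)
  where open ≡-Reasoning

≡1+k*q⇒≡1-mod : ∀ {x} k {q} → x ≡ 1 + k * q → x ≡ 1 mod q
≡1+k*q⇒≡1-mod k eq = 0 , k , trans (+-identityʳ _) eq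

coprime⇒*-≢-mod : ∀ {a q x y} → Coprime a q → x < y → y < q → ¬ (a * x ≡ a * y mod q)
coprime⇒*-≢-mod {a} {q} {x} {y} cop x<y y<q (m , n , ax≡ay) = <⇒≱ y<q (≤-trans q≤d (m∸n≤m y x))
  where
  open ≡-Reasoning
  d : ℕ
  d = y ∸ x
  mq≡ad+nq : m * q ≡ a * d + n * q
  mq≡ad+nq = +-cancelˡ-≡ (a * x) _ _ (begin
    a * x + m * q            ≡⟨ ax≡ay ⟩
    a * y + n * q            ≡⟨ cong (λ z → a * z + n * q) (sym (m+[n∸m]≡n (<⇒≤ x<y))) ⟩
    a * (x + d) + n * q      ≡⟨ cong (_+ n * q) (*-distribˡ-+ a x d) ⟩
    a * x + a * d + n * q    ≡⟨ +-assoc (a * x) (a * d) (n * q) ⟩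
    a * x + (a * d + n * q)  ∎)
  q∣ad : q ∣ a * d
  q∣ad = ∣m+n∣m⇒∣n (subst (q ∣_) (trans mq≡ad+nq (+-comm (a * d) (n * q))) (n∣m*n m)) (n∣m*n n)
  q≤d : q ≤ d
  q≤d = ∣⇒≤ {{>-nonZero (m<n⇒0<n∸m x<y)}} (coprime-divisor (Coprime.sym cop) q∣ad)

*-cancelˡ-≡-mod : ∀ {a q x y} → Coprime a q → x < q → y < q → a * x ≡ a * y mod q → x ≡ y
*-cancelˡ-≡-mod {x = x} {y} cop x<q y<q ax≡ay with <-cmp x y
... | tri< x<y _ _ = ⊥-elim (coprime⇒*-≢-mod cop x<y y<q ax≡ay)
... | tri≈ _ x≡y _ = x≡y
... | tri> _ _ y<x = ⊥-elim (coprime⇒*-≢-mod cop y<x x<q (≡-mod-sym ax≡ay))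

mod-inverse-unique : ∀ {a q x y} → Coprime a q → x < q → y < q →
  a * x ≡ 1 mod q → a * y ≡ 1 mod q → x ≡ y
mod-inverse-unique cop x<q y<q ax≡1 ay≡1 =
  *-cancelˡ-≡-mod cop x<q y<q (≡-mod-trans ax≡1 (≡-mod-sym ay≡1))

unimodular⇒coprime : ∀ a b c d → a * b ≡ 1 + c * d → Coprime a d
unimodular⇒coprime a b c d ab≡1+cd {k} (k∣a , k∣d) = ∣1⇒≡1 (∣m+n∣m⇒∣n k∣cd+1 (∣n⇒∣m*n c k∣d))
  where
  k∣cd+1 : k ∣ c * d + 1
  k∣cd+1 = subst (k ∣_) (trans ab≡1+cd (+-comm 1 (c * d))) (∣m⇒∣m*n b k∣a)

residue-in-window : ∀ Q d c .{{_ : NonZero d}} → d ≤ Q → ∃ λ q → q ≤ Q × Q < d + q × d ∣ q + c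
residue-in-window Q d c d≤Q = Q ∸ r , m∸n≤m Q r , Q<d+q , divides ((Q + c) / d) q+c≡[Q+c]/d*d
  where
  open ≡-Reasoning
  r : ℕ
  r = (Q + c) % d
  r+q≡Q : r + (Q ∸ r) ≡ Q
  r+q≡Q = m+[n∸m]≡n (≤-trans (<⇒≤ (m%n<n (Q + c) d)) d≤Q)
  Q<d+q : Q < d + (Q ∸ r)
  Q<d+q = subst (_< d + (Q ∸ r)) r+q≡Q (+-monoˡ-< (Q ∸ r) (m%n<n (Q + c) d))
  q+c≡[Q+c]/d*d : Q ∸ r + c ≡ (Q + c) / d * d
  q+c≡[Q+c]/d*d = +-cancelˡ-≡ r _ _ (begin
    r + (Q ∸ r + c)      ≡⟨ +-assoc r (Q ∸ r) c ⟨
    r + (Q ∸ r) + c      ≡⟨ cong (_+ c) r+q≡Q ⟩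
    Q + c                ≡⟨ m≡m%n+[m/n]*n (Q + c) d ⟩
    r + (Q + c) / d * d  ∎)

-- Choosing q ≡ −ā (mod q₁) makes a₁q + 1 a multiple of q₁.
right-neighbour : ∀ {Q} a₁ q₁ ā k .{{_ : NonZero q₁}} → q₁ ≤ Q → a₁ * ā ≡ 1 + k * q₁ →
  ∃₂ λ a q → a * q₁ ≡ 1 + a₁ * q × q ≤ Q × Q < q₁ + q
right-neighbour {Q} a₁ q₁ ā k q₁≤Q a₁ā≡1 with residue-in-window Q q₁ ā q₁≤Q
... | q , q≤Q , Q<q₁+q , divides m q+ā≡m*q₁ = a₁ * m ∸ k , q , aq₁≡1+a₁q , q≤Q , Q<q₁+q
  where
  open ≡-Reasoning
  a₁mq₁≡ : a₁ * m * q₁ ≡ 1 + a₁ * q + k * q₁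
  a₁mq₁≡ = begin
    a₁ * m * q₁            ≡⟨ *-assoc a₁ m q₁ ⟩
    a₁ * (m * q₁)          ≡⟨ cong (a₁ *_) q+ā≡m*q₁ ⟨
    a₁ * (q + ā)           ≡⟨ *-distribˡ-+ a₁ q ā ⟩
    a₁ * q + a₁ * ā        ≡⟨ cong (a₁ * q +_) a₁ā≡1 ⟩
    a₁ * q + (1 + k * q₁)  ≡⟨ solve (a₁ ∷ q ∷ k ∷ q₁ ∷ []) ⟩
    1 + a₁ * q + k * q₁    ∎
  aq₁≡1+a₁q : (a₁ * m ∸ k) * q₁ ≡ 1 + a₁ * q
  aq₁≡1+a₁q = begin
    (a₁ * m ∸ k) * q₁             ≡⟨ *-distribʳ-∸ q₁ (a₁ * m) k ⟩
    a₁ * m * q₁ ∸ k * q₁          ≡⟨ cong (_∸ k * q₁) a₁mq₁≡ ⟩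
    1 + a₁ * q + k * q₁ ∸ k * q₁  ≡⟨ m+n∸n≡m (1 + a₁ * q) (k * q₁) ⟩
    1 + a₁ * q                    ∎

-- q₂ = q₁ (aq₂ − a₂q) + q (a₂q₁ − a₁q₂), and both brackets are positive.
between-unimodular⇒+≤ : ∀ a₁ q₁ a q a₂ q₂ → a * q₁ ≡ 1 + a₁ * q →
  a₁ ⟨ q₁ ⟩<⟨ a₂ ⟩ q₂ → a₂ ⟨ q₂ ⟩<⟨ a ⟩ q → q₁ + q ≤ q₂
between-unimodular⇒+≤ a₁ q₁ a q a₂ q₂ aq₁≡1+a₁q a₁q₂<a₂q₁ a₂q<aq₂ =
  +-cancelʳ-≤ (a₁ * q * q₂) (q₁ + q) q₂ (begin
    q₁ + q + a₁ * q * q₂      ≡⟨ solve (q₁ ∷ q ∷ a₁ ∷ q₂ ∷ []) ⟩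
    q₁ + (1 + a₁ * q₂) * q    ≤⟨ +-monoʳ-≤ q₁ (*-monoˡ-≤ q a₁q₂<a₂q₁) ⟩
    q₁ + a₂ * q₁ * q          ≡⟨ solve (q₁ ∷ a₂ ∷ q ∷ []) ⟩
    (1 + a₂ * q) * q₁         ≤⟨ *-monoˡ-≤ q₁ a₂q<aq₂ ⟩
    a * q₂ * q₁               ≡⟨ solve (a ∷ q₂ ∷ q₁ ∷ []) ⟩
    a * q₁ * q₂               ≡⟨ cong (_* q₂) aq₁≡1+a₁q ⟩
    (1 + a₁ * q) * q₂         ≡⟨ solve (a₁ ∷ q ∷ q₂ ∷ []) ⟩
    q₂ + a₁ * q * q₂          ∎)
  where open ≤-Reasoning

same-value-coprime⇒≡ : ∀ a q b r → Coprime a q → Coprime b r → a * r ≡ b * q → a ≡ b × q ≡ r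
same-value-coprime⇒≡ a q b r a⊥q b⊥r ar≡bq = ∣-antisym a∣b b∣a , ∣-antisym q∣r r∣q
  where
  a∣b : a ∣ b
  a∣b = coprime-divisor a⊥q (subst (a ∣_) (trans ar≡bq (*-comm b q)) (m∣m*n r))
  b∣a : b ∣ a
  b∣a = coprime-divisor b⊥r (subst (b ∣_) (trans (sym ar≡bq) (*-comm a r)) (m∣m*n q))
  q∣r : q ∣ r
  q∣r = coprime-divisor (Coprime.sym a⊥q) (subst (q ∣_) (sym ar≡bq) (n∣m*n b))
  r∣q : r ∣ q
  r∣q = coprime-divisor (Coprime.sym b⊥r) (subst (r ∣_) ar≡bq (n∣m*n a))

fraction<≤1⇒num<den : ∀ {a q b r} → a ⟨ q ⟩<⟨ b ⟩ r → b ≤ r → a < q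
fraction<≤1⇒num<den {a} {q} {b} {r} ar<bq b≤r =
  *-cancelʳ-< r a q (<-≤-trans ar<bq (≤-trans (*-monoˡ-≤ q b≤r) (≤-reflexive (*-comm r q))))

unimodular⇒InFarey : ∀ {Q} a₁ q₁ a q → a * q₁ ≡ 1 + a₁ * q → a < q → q ≤ Q → InFarey Q a q
unimodular⇒InFarey a₁ q₁ a q aq₁≡1+a₁q a<q q≤Q =
  n≢0⇒n>0 (λ { refl → 0≢1+n aq₁≡1+a₁q }) , <⇒≤ a<q , q≤Q , unimodular⇒coprime a q₁ a₁ q aq₁≡1+a₁q

farey-neighbours⇒unimodular : ∀ {Q a₁ q₁ a₂ q₂} ā k → a₁ * ā ≡ 1 + k * q₁ →
  Consecutive (InFarey Q) a₁ q₁ a₂ q₂ → a₂ * q₁ ≡ 1 + a₁ * q₂ × Q < q₁ + q₂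
farey-neighbours⇒unimodular {a₁ = a₁} {q₁} {a₂} {q₂} ā k a₁ā≡1
  ((1≤a₁ , a₁≤q₁ , q₁≤Q , _) , (_ , a₂≤q₂ , q₂≤Q , a₂⊥q₂) , a₁/q₁<a₂/q₂ , nothing-between)
  with right-neighbour a₁ q₁ ā k {{>-nonZero (≤-trans 1≤a₁ a₁≤q₁)}} q₁≤Q a₁ā≡1
... | a , q , aq₁≡1+a₁q , q≤Q , Q<q₁+q with <-cmp (a * q₂) (a₂ * q)
... | tri< a/q<a₂/q₂ _ _ = ⊥-elim (nothing-between a q
        (unimodular⇒InFarey a₁ q₁ a q aq₁≡1+a₁q (fraction<≤1⇒num<den a/q<a₂/q₂ a₂≤q₂) q≤Q)
        (≤-reflexive (sym aq₁≡1+a₁q) , a/q<a₂/q₂))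
... | tri> _ _ a₂/q₂<a/q =
  ⊥-elim (<⇒≱ Q<q₁+q (≤-trans
    (between-unimodular⇒+≤ a₁ q₁ a q a₂ q₂ aq₁≡1+a₁q a₁/q₁<a₂/q₂ a₂/q₂<a/q) q₂≤Q))
... | tri≈ _ a/q≡a₂/q₂ _
  with same-value-coprime⇒≡ a q a₂ q₂ (unimodular⇒coprime a q₁ a₁ q aq₁≡1+a₁q) a₂⊥q₂ a/q≡a₂/q₂
...   | refl , refl = aq₁≡1+a₁q , Q<q₁+q

HLe-proper : ∀ {Q a q a₂ q₂} → a ⟨ q ⟩<⟨ a₂ ⟩ q₂ → a₂ ≤ q₂ → HLe Q a q →
  2 ≤ q × ∃ λ ā → IsInvMod q a ā × q + a + ā ≤ Q
HLe-proper a/q<a₂/q₂ a₂≤q₂ (inj₁ (refl , refl , _)) =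
  ⊥-elim (n≮n 1 (fraction<≤1⇒num<den a/q<a₂/q₂ a₂≤q₂))
HLe-proper _ _ (inj₂ h) = h

HLe-neighbour⇒< : ∀ {Q} a₁ q₁ a₂ q₂ → 2 ≤ q₁ → a₂ * q₁ ≡ 1 + a₁ * q₂ → Q < q₁ + q₂ →
  HLe Q a₂ q₂ → q₂ < q₁
HLe-neighbour⇒< {Q} a₁ q₁ a₂ q₂ 2≤q₁ a₂q₁≡1+a₁q₂ Q<q₁+q₂ h₂ = ≰⇒> (¬q₁≤q₂ h₂)
  where
  ¬q₁≤q₂ : HLe Q a₂ q₂ → ¬ q₁ ≤ q₂
  ¬q₁≤q₂ (inj₁ (_ , refl , _)) q₁≤1 = <⇒≱ 2≤q₁ q₁≤1
  ¬q₁≤q₂ (inj₂ (_ , ā₂ , (_ , ā₂<q₂ , k₂ , a₂ā₂≡1) , h₂≤Q)) q₁≤q₂ = <⇒≱ Q<q₁+q₂ (begin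
    q₁ + q₂       ≡⟨ +-comm q₁ q₂ ⟩
    q₂ + q₁       ≤⟨ +-monoˡ-≤ q₁ (m≤m+n q₂ a₂) ⟩
    q₂ + a₂ + q₁  ≡⟨ cong (q₂ + a₂ +_) ā₂≡q₁ ⟨
    q₂ + a₂ + ā₂  ≤⟨ h₂≤Q ⟩
    Q             ∎)
    where
    open ≤-Reasoning
    q₁≢q₂ : q₁ ≢ q₂
    q₁≢q₂ q₁≡q₂ = <⇒≢ 2≤q₁ (sym (unimodular⇒coprime q₁ a₂ a₁ q₂ (trans (*-comm q₁ a₂) a₂q₁≡1+a₁q₂)
                                  (∣-refl , ∣-reflexive q₁≡q₂)))
    ā₂≡q₁ : ā₂ ≡ q₁
    ā₂≡q₁ = mod-inverse-unique (unimodular⇒coprime a₂ q₁ a₁ q₂ a₂q₁≡1+a₁q₂)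
              ā₂<q₂ (≤∧≢⇒< q₁≤q₂ q₁≢q₂) (≡1+k*q⇒≡1-mod k₂ a₂ā₂≡1) (≡1+k*q⇒≡1-mod a₁ a₂q₁≡1+a₁q₂)

unimodular⇒inverse+q₂≡q₁ : ∀ a₁ q₁ a₂ q₂ {ā} k → ā < q₁ → a₁ * ā ≡ 1 + k * q₁ →
  a₂ * q₁ ≡ 1 + a₁ * q₂ → 0 < q₂ → q₂ ≤ q₁ → ā + q₂ ≡ q₁
unimodular⇒inverse+q₂≡q₁ a₁ q₁ a₂ q₂ {ā} k ā<q₁ a₁ā≡1 a₂q₁≡1+a₁q₂ 0<q₂ q₂≤q₁
  with m≤n⇒∃[o]m+o≡n q₂≤q₁
... | e , refl = trans (cong (_+ q₂) ā≡e) (+-comm e q₂)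
  where
  open ≡-Reasoning
  a₁e≡1 : a₁ * e ≡ 1 mod (q₂ + e)
  a₁e≡1 = a₂ , a₁ , (begin
    a₁ * e + a₂ * (q₂ + e)  ≡⟨ cong (a₁ * e +_) a₂q₁≡1+a₁q₂ ⟩
    a₁ * e + (1 + a₁ * q₂)  ≡⟨ solve (a₁ ∷ e ∷ q₂ ∷ []) ⟩
    1 + a₁ * (q₂ + e)       ∎)
  ā≡e : ā ≡ e
  ā≡e = mod-inverse-unique (unimodular⇒coprime a₁ ā k (q₂ + e) a₁ā≡1) ā<q₁ (m<n+m e 0<q₂)
          (≡1+k*q⇒≡1-mod k a₁ā≡1) a₁e≡1

h-bound⇒InQV₁ : ∀ {Q a₁ ā q₁ q₂} → q₁ + a₁ + ā ≤ Q → Q < q₁ + q₂ → ā + q₂ ≡ q₁ → InQV₁ Q q₁ q₂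
h-bound⇒InQV₁ {Q} {a₁} {ā} {q₁} {q₂} h≤Q Q<q₁+q₂ ā+q₂≡q₁ =
  Q≤2q₁ , q₁≤Q , Q≤3q₂ , ≤-trans q₂≤q₁ q₁≤Q , <⇒≤ Q<q₁+q₂ , 2q₁≤Q+q₂ , q₂≤q₁
  where
  open ≤-Reasoning
  q₂≤q₁ : q₂ ≤ q₁
  q₂≤q₁ = subst (q₂ ≤_) ā+q₂≡q₁ (m≤n+m q₂ ā)
  q₁+ā≤Q : q₁ + ā ≤ Q
  q₁+ā≤Q = ≤-trans (+-monoˡ-≤ ā (m≤m+n q₁ a₁)) h≤Q
  q₁≤Q : q₁ ≤ Q
  q₁≤Q = ≤-trans (m≤m+n q₁ ā) q₁+ā≤Q
  ā<q₂ : ā < q₂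
  ā<q₂ = +-cancelˡ-< q₁ ā q₂ (≤-<-trans q₁+ā≤Q Q<q₁+q₂)
  Q≤2q₁ : Q ≤ 2 * q₁
  Q≤2q₁ = begin
    Q        ≤⟨ <⇒≤ Q<q₁+q₂ ⟩
    q₁ + q₂  ≤⟨ +-monoʳ-≤ q₁ q₂≤q₁ ⟩
    q₁ + q₁  ≡⟨ solve (q₁ ∷ []) ⟩
    2 * q₁   ∎
  Q≤3q₂ : Q ≤ 3 * q₂
  Q≤3q₂ = begin
    Q             ≤⟨ <⇒≤ Q<q₁+q₂ ⟩
    q₁ + q₂       ≡⟨ cong (_+ q₂) ā+q₂≡q₁ ⟨
    ā + q₂ + q₂   ≤⟨ +-monoˡ-≤ q₂ (+-monoˡ-≤ q₂ (<⇒≤ ā<q₂)) ⟩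
    q₂ + q₂ + q₂  ≡⟨ solve (q₂ ∷ []) ⟩
    3 * q₂        ∎
  2q₁≤Q+q₂ : 2 * q₁ ≤ Q + q₂
  2q₁≤Q+q₂ = begin
    2 * q₁          ≡⟨ solve (q₁ ∷ []) ⟩
    q₁ + q₁         ≡⟨ cong (q₁ +_) ā+q₂≡q₁ ⟨
    q₁ + (ā + q₂)   ≡⟨ +-assoc q₁ ā q₂ ⟨
    q₁ + ā + q₂     ≤⟨ +-monoˡ-≤ q₂ q₁+ā≤Q ⟩
    Q + q₂          ∎

lemma4 : (Q : ℕ) → 3 ≤ Q → (a₁ q₁ a₂ q₂ : ℕ) →
    Consecutive (InSF Q) a₁ q₁ a₂ q₂ →
    Consecutive (InFarey Q) a₁ q₁ a₂ q₂ →
    InQV₁ Q q₁ q₂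
lemma4 Q _ a₁ q₁ a₂ q₂ ((_ , _ , _ , h₁) , (1≤a₂ , a₂≤q₂ , _ , h₂) , a₁/q₁<a₂/q₂ , _) farey
  with HLe-proper a₁/q₁<a₂/q₂ a₂≤q₂ h₁
... | 2≤q₁ , ā₁ , (_ , ā₁<q₁ , k₁ , a₁ā₁≡1) , h₁≤Q
  with farey-neighbours⇒unimodular ā₁ k₁ a₁ā₁≡1 farey
... | a₂q₁≡1+a₁q₂ , Q<q₁+q₂ = h-bound⇒InQV₁ h₁≤Q Q<q₁+q₂ ā₁+q₂≡q₁
  where
  q₂<q₁ : q₂ < q₁
  q₂<q₁ = HLe-neighbour⇒< a₁ q₁ a₂ q₂ 2≤q₁ a₂q₁≡1+a₁q₂ Q<q₁+q₂ h₂
  ā₁+q₂≡q₁ : ā₁ + q₂ ≡ q₁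
  ā₁+q₂≡q₁ = unimodular⇒inverse+q₂≡q₁ a₁ q₁ a₂ q₂ k₁ ā₁<q₁ a₁ā₁≡1 a₂q₁≡1+a₁q₂
               (≤-trans 1≤a₂ a₂≤q₂) (<⇒≤ q₂<q₁)
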